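{- On all finite structures, DATALOG$^{*}\subseteq$ DATALOG$^{r}\equiv$ DATALOG$^{*r}$.
   Context: All structures are finite. A DATALOG program $\Pi$ over a vocabulary $\tau$ is a finite set of rules $\beta\leftarrow\alpha_1,\dots,\alpha_l$ ($l\ge0$), each $\alpha_i$ an atomic formula, a negated atomic formula, or a zero-ary relation symbol, the head $\beta$ an atomic formula $R\bar x$ or a zero-ary relation symbol. Relation symbols occurring in heads are intentional; all other symbols of $\tau$ (including constants) are extensional, forming $(\tau,\Pi)_{ext}$; intentional symbols occur only positively. DATALOG$^*$ programs additionally allow in bodies first-order formulas containing only extensional symbols; DATALOG$^r$ programs additionally allow formulas $\forall\bar yR\bar y\bar z$ with $R$ intentional; DATALOG$^{*r}$ programs allow both. Semantics: for a finite $(\tau,\Pi)_{ext}$-structure $\mathcal A$, intentional relations start empty and stage $i+1$ of $R$ is the set of tuples $\bar a$ such that for some rule with head $R\bar x$ and some assignment mapping $\bar x$ to $\bar a$ all body formulas hold in $\mathcal A$ expanded by the stage-$i$ relations; stages increase to a fixed point, and $\mathcal A[\Pi]$ is $\mathcal A$ expanded by the fixed points. A formula $(\Pi,P)\bar t$ ($P$ an $r$-ary intentional symbol, $\bar t$ new variables) is a formula over $(\tau,\Pi)_{ext}$ holding of $\bar a$ iff $\bar a\in P^{\mathcal A[\Pi]}$. $\mathcal L_1\subseteq\mathcal L_2$ means every $\mathcal L_1$ formula has an equivalent $\mathcal L_2$ formula over the same (extensional) vocabulary; $\equiv$ means inclusion both ways. -}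

module Defs where

open import Data.Nat using (ℕ; zero; suc; _+_)
open import Data.Fin using (Fin; zero; suc; _≟_)
open import Data.Bool using (Bool; true; false; _∧_; _∨_; not; T)
open import Data.Vec using (Vec; []; _∷_; lookup; map; _++_)
open import Data.Vec.Properties using (≡-dec)
open import Data.List using (List)
import Data.Bool.ListAction as L
open import Data.List.Relation.Unary.Any using (Any)
open import Data.Product using (Σ; _×_)
open import Relation.Binary.PropositionalEquality using (_≡_; refl; subst; sym)
open import Relation.Nullary.Decidable using (⌊_⌋)
open import Relation.Nullary using (yes; no)
open import Function.Bundles using (_⇔_)

someFin : (m : ℕ) → (Fin m → Bool) → Bool
someFin zero    p = false
someFin (suc m) p = p zero ∨ someFin m (λ i → p (suc i))

everyFin : (m : ℕ) → (Fin m → Bool) → Bool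
everyFin zero    p = true
everyFin (suc m) p = p zero ∧ everyFin m (λ i → p (suc i))

someVec : (m k : ℕ) → (Vec (Fin m) k → Bool) → Bool
someVec m zero    p = p []
someVec m (suc k) p = someFin m (λ a → someVec m k (λ v → p (a ∷ v)))

everyVec : (m k : ℕ) → (Vec (Fin m) k → Bool) → Bool
everyVec m zero    p = p []
everyVec m (suc k) p = everyFin m (λ a → everyVec m k (λ v → p (a ∷ v)))

record Vocab : Set where
  field
    nRel   : ℕ
    arity  : Fin nRel → ℕ
    nConst : ℕ

-- A finite structure; its universe is Fin (suc size) (nonempty, finite).
record Structure (σ : Vocab) : Set where
  open Vocab σ
  field
    size  : ℕ
    rel   : (R : Fin nRel) → Vec (Fin (suc size)) (arity R) → Bool
    const : Fin nConst → Fin (suc size)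

Universe : {σ : Vocab} → Structure σ → Set
Universe A = Fin (suc (Structure.size A))

data Term (σ : Vocab) (m : ℕ) : Set where
  var : Fin m → Term σ m
  con : Fin (Vocab.nConst σ) → Term σ m

evalTerm : {σ : Vocab} {m : ℕ} (A : Structure σ) → Vec (Universe A) m → Term σ m → Universe A
evalTerm A s (var x) = lookup s x
evalTerm A s (con c) = Structure.const A c

-- de Bruijn: the quantified variable is 'zero' in the extended scope
data FO (σ : Vocab) : ℕ → Set where
  _≐_  : {m : ℕ} → Term σ m → Term σ m → FO σ m
  rel  : {m : ℕ} (R : Fin (Vocab.nRel σ)) → Vec (Term σ m) (Vocab.arity σ R) → FO σ m
  ¬'_  : {m : ℕ} → FO σ m → FO σ m
  _∧'_ : {m : ℕ} → FO σ m → FO σ m → FO σ m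
  _∨'_ : {m : ℕ} → FO σ m → FO σ m → FO σ m
  ∃'   : {m : ℕ} → FO σ (suc m) → FO σ m
  ∀'   : {m : ℕ} → FO σ (suc m) → FO σ m

evalFO : {σ : Vocab} {m : ℕ} (A : Structure σ) → Vec (Universe A) m → FO σ m → Bool
evalFO A s (t ≐ u)   = ⌊ evalTerm A s t ≟ evalTerm A s u ⌋
evalFO A s (rel R ts) = Structure.rel A R (map (evalTerm A s) ts)
evalFO A s (¬' φ)    = not (evalFO A s φ)
evalFO A s (φ ∧' ψ)  = evalFO A s φ ∧ evalFO A s ψ
evalFO A s (φ ∨' ψ)  = evalFO A s φ ∨ evalFO A s ψ
evalFO A s (∃' φ)    = someFin (suc (Structure.size A)) (λ a → evalFO A (a ∷ s) φ)
evalFO A s (∀' φ)    = everyFin (suc (Structure.size A)) (λ a → evalFO A (a ∷ s) φ)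

data Dialect : Set where
  DATALOG DATALOG* DATALOGʳ DATALOG*ʳ : Dialect

allowsFO : Dialect → Bool
allowsFO DATALOG   = false
allowsFO DATALOG*  = true
allowsFO DATALOGʳ  = false
allowsFO DATALOG*ʳ = true

-- may bodies contain ∀ȳ R ȳ z̄ with R intentional?
allowsForall : Dialect → Bool
allowsForall DATALOG   = false
allowsForall DATALOG*  = false
allowsForall DATALOGʳ  = true
allowsForall DATALOG*ʳ = true

-- Body formulas of a rule with nv variables.  σ is the extensional
-- vocabulary (τ,Π)_ext; intentional symbols are Fin nI with arities iar.
-- Intentional symbols occur only positively.
data Lit (d : Dialect) (σ : Vocab) (nI : ℕ) (iar : Fin nI → ℕ) (nv : ℕ) : Set where
  posE : (R : Fin (Vocab.nRel σ)) → Vec (Term σ nv) (Vocab.arity σ R) → Lit d σ nI iar nv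
  negE : (R : Fin (Vocab.nRel σ)) → Vec (Term σ nv) (Vocab.arity σ R) → Lit d σ nI iar nv
  eqA  : Term σ nv → Term σ nv → Lit d σ nI iar nv
  neqA : Term σ nv → Term σ nv → Lit d σ nI iar nv
  posI : (P : Fin nI) → Vec (Term σ nv) (iar P) → Lit d σ nI iar nv
  foL  : T (allowsFO d) → FO σ nv → Lit d σ nI iar nv
  -- DATALOGʳ : ∀ y₁…y_k  P y₁ … y_k z̄   (ȳ distinct bound variables, z̄ rule variables)
  allI : T (allowsForall d) → (P : Fin nI) (k l : ℕ) → k + l ≡ iar P →
         Vec (Fin nv) l → Lit d σ nI iar nv

Interp : (nI : ℕ) → (Fin nI → ℕ) → Set → Set
Interp nI iar U = (P : Fin nI) → Vec U (iar P) → Bool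

evalLit : {d : Dialect} {σ : Vocab} {nI : ℕ} {iar : Fin nI → ℕ} {nv : ℕ}
          (A : Structure σ) → Interp nI iar (Universe A) → Vec (Universe A) nv →
          Lit d σ nI iar nv → Bool
evalLit A J s (posE R ts)   = Structure.rel A R (map (evalTerm A s) ts)
evalLit A J s (negE R ts)   = not (Structure.rel A R (map (evalTerm A s) ts))
evalLit A J s (eqA t u)     = ⌊ evalTerm A s t ≟ evalTerm A s u ⌋
evalLit A J s (neqA t u)    = not ⌊ evalTerm A s t ≟ evalTerm A s u ⌋
evalLit A J s (posI P ts)   = J P (map (evalTerm A s) ts)
evalLit A J s (foL _ φ)     = evalFO A s φ
evalLit A J s (allI _ P k l eq zs) =
  everyVec (suc (Structure.size A)) k
    (λ ys → J P (subst (Vec (Universe A)) eq (ys ++ map (lookup s) zs)))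

record Rule (d : Dialect) (σ : Vocab) (nI : ℕ) (iar : Fin nI → ℕ) : Set where
  field
    nv    : ℕ
    head  : Fin nI
    hargs : Vec (Fin nv) (iar head)
    body  : List (Lit d σ nI iar nv)

-- A program of dialect d with extensional vocabulary σ.  Every intentional
-- symbol occurs in the head of some rule (intentional = occurring in a head).
record Program (d : Dialect) (σ : Vocab) : Set where
  field
    nI     : ℕ
    iar    : Fin nI → ℕ
    rules  : List (Rule d σ nI iar)
    headed : (P : Fin nI) → Any (λ ρ → Rule.head ρ ≡ P) rules

module _ {d : Dialect} {σ : Vocab} (Π : Program d σ) (A : Structure σ) where
  open Program Π

  matches : (ρ : Rule d σ nI iar) (P : Fin nI) → Vec (Universe A) (iar P) →
            Vec (Universe A) (Rule.nv ρ) → Bool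
  matches ρ P ā s with Rule.head ρ ≟ P
  ... | yes refl = ⌊ ≡-dec _≟_ (map (lookup s) (Rule.hargs ρ)) ā ⌋
  ... | no _     = false

  stage : ℕ → Interp nI iar (Universe A)
  stage zero    P ā = false
  stage (suc i) P ā =
    L.any (λ ρ → someVec (suc (Structure.size A)) (Rule.nv ρ)
                   (λ s → matches ρ P ā s ∧ L.all (evalLit A (stage i) s) (Rule.body ρ)))
          rules

  -- ā ∈ P^{A[Π]}  (the fixed point = union of the increasing stages)
  InFixpoint : (P : Fin nI) → Vec (Universe A) (iar P) → Set
  InFixpoint P ā = Σ ℕ (λ i → stage i P ā ≡ true)

record DFormula (d : Dialect) (σ : Vocab) (r : ℕ) : Set where
  field
    prog     : Program d σ
    goal     : Fin (Program.nI prog)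
    goalAr   : Program.iar prog goal ≡ r

Holds : {d : Dialect} {σ : Vocab} {r : ℕ} → DFormula d σ r →
        (A : Structure σ) → Vec (Universe A) r → Set
Holds φ A ā = InFixpoint (DFormula.prog φ) A (DFormula.goal φ)
                (subst (Vec (Universe A)) (sym (DFormula.goalAr φ)) ā)

_⊑_ : Dialect → Dialect → Set
d₁ ⊑ d₂ = (σ : Vocab) (r : ℕ) (φ : DFormula d₁ σ r) →
          Σ (DFormula d₂ σ r) (λ ψ →
            (A : Structure σ) (ā : Vec (Universe A) r) → Holds φ A ā ⇔ Holds ψ A ā)

_≡ᴸ_ : Dialect → Dialect → Set
d₁ ≡ᴸ d₂ = (d₁ ⊑ d₂) × (d₂ ⊑ d₁)

module Submission where

-- A program of a weaker dialect is literally a program of a stronger one, which gives the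
-- inclusions into DATALOG*ʳ.  The real content is DATALOG*ʳ ⊆ DATALOGʳ: every first-order
-- body formula is replaced by a fresh intentional symbol.  Each pair (φ, b) of a subformula
-- and a truth value gets a symbol whose rules make it hold of v exactly when φ evaluates to
-- b at v: conjunctions and disjunctions become one or two rules over the symbols of the
-- parts, ∃ becomes an extra rule variable, ∀ becomes the body formula ∀y R y z̄ of DATALOGʳ,
-- and ¬ merely flips b, ending in negated extensional atoms, so intentional symbols still
-- occur only positively.  The auxiliary relations depend on the structure alone and each
-- refers only to earlier ones, so they are exact after a fixed number h of stages.  Hence
-- everything the original program derives by stage i the translation derives by stage
-- h + i, and conversely the translation derives no original fact the program does not.

open import Defs
open import Data.Nat using (ℕ; zero; suc; _+_; _<_; _≤_; s≤s; z≤n)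
open import Data.Nat.Properties using (+-suc; m≤m+n; <-≤-trans; ≤-refl; m<n⇒m<1+n)
open import Data.Fin using (Fin; zero; suc; _≟_)
open import Data.Bool using (Bool; true; false; _∧_; _∨_; not; T)
open import Data.Bool.Properties using (not-involutive; T-≡)
open import Data.Vec using (Vec; []; _∷_; lookup; map; tabulate; allFin)
open import Data.Vec.Properties using (map-lookup-allFin; tabulate∘lookup; tabulate-∘)
import Data.Vec.Functional as VF
open import Data.List using (List; []; _∷_) renaming (map to mapL; _++_ to _++L_)
open import Data.List.Properties using (map-∘; map-cong)
import Data.Bool.ListAction as L
open import Data.List.Relation.Unary.Any using (Any; here; there)
import Data.List.Relation.Unary.Any as Any
import Data.List.Relation.Unary.Any.Properties as AnyP
open import Data.List.Relation.Unary.All using (All; []; _∷_)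
import Data.List.Relation.Unary.All as All
import Data.List.Relation.Unary.All.Properties as AllP
open import Data.List.Membership.Propositional using (_∈_)
open import Data.List.Membership.Propositional.Properties
  using (∈-++⁻; ∈-++⁺ˡ; ∈-++⁺ʳ; ∈-map⁺; ∈-map⁻)
open import Data.Maybe using (Maybe; just; nothing)
import Data.Maybe.Relation.Unary.All as Maybe
open import Data.Product using (Σ; ∃; ∃₂; _×_; _,_; proj₁; proj₂) renaming (map to Σ-map)
open import Data.Sum using (_⊎_; inj₁; inj₂)
open import Data.Empty using (⊥; ⊥-elim)
open import Data.Unit using (tt)
open import Function.Base using (id; _∘_)
open import Function.Bundles using (_⇔_; mk⇔; Equivalence)
open import Relation.Binary.PropositionalEquality
open import Relation.Nullary using (yes; no)
open import Relation.Nullary.Decidable using (toWitness; fromWitness)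

open Rule using (head; hargs; body)

∧-true⁻ : ∀ a {b} → a ∧ b ≡ true → a ≡ true × b ≡ true
∧-true⁻ true e = refl , e

∧-true⁺ : ∀ {a b} → a ≡ true → b ≡ true → a ∧ b ≡ true
∧-true⁺ refl refl = refl

∨-true⁻ : ∀ a {b} → a ∨ b ≡ true → a ≡ true ⊎ b ≡ true
∨-true⁻ true  _ = inj₁ refl
∨-true⁻ false e = inj₂ e

∨-trueˡ : ∀ {a} b → a ≡ true → a ∨ b ≡ true
∨-trueˡ b refl = refl

∨-trueʳ : ∀ a {b} → b ≡ true → a ∨ b ≡ true
∨-trueʳ true  _ = refl
∨-trueʳ false e = e

∧-false⁻ : ∀ a {b} → a ∧ b ≡ false → a ≡ false ⊎ b ≡ false
∧-false⁻ false _ = inj₁ refl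
∧-false⁻ true  e = inj₂ e

∧-falseˡ : ∀ {a} b → a ≡ false → a ∧ b ≡ false
∧-falseˡ b refl = refl

∧-falseʳ : ∀ a {b} → b ≡ false → a ∧ b ≡ false
∧-falseʳ true  e = e
∧-falseʳ false _ = refl

∨-false⁻ : ∀ a {b} → a ∨ b ≡ false → a ≡ false × b ≡ false
∨-false⁻ false e = refl , e

∨-false⁺ : ∀ {a b} → a ≡ false → b ≡ false → a ∨ b ≡ false
∨-false⁺ refl refl = refl

not-transpose : ∀ {x b} → not x ≡ b → x ≡ not b
not-transpose {x} refl = sym (not-involutive x)

not-transpose⁻ : ∀ {x} b → x ≡ not b → not x ≡ b
not-transpose⁻ b refl = not-involutive b

any-true⁻ : ∀ {X : Set} (f : X → Bool) xs → L.any f xs ≡ true → ∃ λ x → x ∈ xs × f x ≡ true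
any-true⁻ f (x ∷ xs) e with ∨-true⁻ (f x) e
... | inj₁ fx = x , here refl , fx
... | inj₂ rest with any-true⁻ f xs rest
...   | y , y∈xs , fy = y , there y∈xs , fy

any-true⁺ : ∀ {X : Set} (f : X → Bool) {x} xs → x ∈ xs → f x ≡ true → L.any f xs ≡ true
any-true⁺ f (y ∷ xs) (here refl)  fx = ∨-trueˡ (L.any f xs) fx
any-true⁺ f (y ∷ xs) (there x∈xs) fx = ∨-trueʳ (f y) (any-true⁺ f xs x∈xs fx)

all-true⁻ : ∀ {X : Set} (f : X → Bool) xs → L.all f xs ≡ true → All (λ x → f x ≡ true) xs
all-true⁻ f []       _ = []
all-true⁻ f (x ∷ xs) e = proj₁ (∧-true⁻ (f x) e) ∷ all-true⁻ f xs (proj₂ (∧-true⁻ (f x) e))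

all-true⁺ : ∀ {X : Set} (f : X → Bool) xs → All (λ x → f x ≡ true) xs → L.all f xs ≡ true
all-true⁺ f []       []         = refl
all-true⁺ f (x ∷ xs) (fx ∷ fxs) = ∧-true⁺ fx (all-true⁺ f xs fxs)

any-map : ∀ {X Y : Set} {f : Y → Bool} {g : X → Y} {h : X → Bool} →
          (∀ x → f (g x) ≡ h x) → ∀ xs → L.any f (mapL g xs) ≡ L.any h xs
any-map f∘g≗h xs = cong L.or (trans (sym (map-∘ xs)) (map-cong f∘g≗h xs))

all-map : ∀ {X Y : Set} {f : Y → Bool} {g : X → Y} {h : X → Bool} →
          (∀ x → f (g x) ≡ h x) → ∀ xs → L.all f (mapL g xs) ≡ L.all h xs
all-map f∘g≗h xs = cong L.and (trans (sym (map-∘ xs)) (map-cong f∘g≗h xs))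

someFin⁻ : ∀ m (p : Fin m → Bool) → someFin m p ≡ true → ∃ λ a → p a ≡ true
someFin⁻ (suc m) p e with ∨-true⁻ (p zero) e
... | inj₁ p0   = zero , p0
... | inj₂ rest = Σ-map suc id (someFin⁻ m (p ∘ suc) rest)

someFin⁺ : ∀ m (p : Fin m → Bool) a → p a ≡ true → someFin m p ≡ true
someFin⁺ (suc m) p zero    pa = ∨-trueˡ _ pa
someFin⁺ (suc m) p (suc a) pa = ∨-trueʳ (p zero) (someFin⁺ m (p ∘ suc) a pa)

someFin-false⁻ : ∀ m (p : Fin m → Bool) → someFin m p ≡ false → ∀ a → p a ≡ false
someFin-false⁻ (suc m) p e zero    = proj₁ (∨-false⁻ (p zero) e)
someFin-false⁻ (suc m) p e (suc a) = someFin-false⁻ m (p ∘ suc) (proj₂ (∨-false⁻ (p zero) e)) a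

someFin-false⁺ : ∀ m (p : Fin m → Bool) → (∀ a → p a ≡ false) → someFin m p ≡ false
someFin-false⁺ zero    p _  = refl
someFin-false⁺ (suc m) p ¬p = ∨-false⁺ (¬p zero) (someFin-false⁺ m (p ∘ suc) (¬p ∘ suc))

everyFin⁻ : ∀ m (p : Fin m → Bool) → everyFin m p ≡ true → ∀ a → p a ≡ true
everyFin⁻ (suc m) p e zero    = proj₁ (∧-true⁻ (p zero) e)
everyFin⁻ (suc m) p e (suc a) = everyFin⁻ m (p ∘ suc) (proj₂ (∧-true⁻ (p zero) e)) a

everyFin⁺ : ∀ m (p : Fin m → Bool) → (∀ a → p a ≡ true) → everyFin m p ≡ true
everyFin⁺ zero    p _   = refl
everyFin⁺ (suc m) p all = ∧-true⁺ (all zero) (everyFin⁺ m (p ∘ suc) (all ∘ suc))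

everyFin-false⁻ : ∀ m (p : Fin m → Bool) → everyFin m p ≡ false → ∃ λ a → p a ≡ false
everyFin-false⁻ (suc m) p e with ∧-false⁻ (p zero) e
... | inj₁ p0   = zero , p0
... | inj₂ rest = Σ-map suc id (everyFin-false⁻ m (p ∘ suc) rest)

everyFin-false⁺ : ∀ m (p : Fin m → Bool) a → p a ≡ false → everyFin m p ≡ false
everyFin-false⁺ (suc m) p zero    pa = ∧-falseˡ _ pa
everyFin-false⁺ (suc m) p (suc a) pa = ∧-falseʳ (p zero) (everyFin-false⁺ m (p ∘ suc) a pa)

someFin-cong : ∀ m {p q : Fin m → Bool} → (∀ a → p a ≡ q a) → someFin m p ≡ someFin m q
someFin-cong zero    _   = refl
someFin-cong (suc m) p≗q = cong₂ _∨_ (p≗q zero) (someFin-cong m (p≗q ∘ suc))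

everyFin-cong : ∀ m {p q : Fin m → Bool} → (∀ a → p a ≡ q a) → everyFin m p ≡ everyFin m q
everyFin-cong zero    _   = refl
everyFin-cong (suc m) p≗q = cong₂ _∧_ (p≗q zero) (everyFin-cong m (p≗q ∘ suc))

someVec⁻ : ∀ m k (p : Vec (Fin m) k → Bool) → someVec m k p ≡ true → ∃ λ v → p v ≡ true
someVec⁻ m zero    p e = [] , e
someVec⁻ m (suc k) p e with someFin⁻ m _ e
... | a , pa = Σ-map (a ∷_) id (someVec⁻ m k (p ∘ (a ∷_)) pa)

someVec⁺ : ∀ m k (p : Vec (Fin m) k → Bool) v → p v ≡ true → someVec m k p ≡ true
someVec⁺ m zero    p []      pv = pv
someVec⁺ m (suc k) p (a ∷ v) pv = someFin⁺ m _ a (someVec⁺ m k (p ∘ (a ∷_)) v pv)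

someVec-cong : ∀ m k {p q : Vec (Fin m) k → Bool} → (∀ v → p v ≡ q v) →
               someVec m k p ≡ someVec m k q
someVec-cong m zero    p≗q = p≗q []
someVec-cong m (suc k) p≗q = someFin-cong m (λ a → someVec-cong m k (p≗q ∘ (a ∷_)))

everyVec-cong : ∀ m k {p q : Vec (Fin m) k → Bool} → (∀ v → p v ≡ q v) →
                everyVec m k p ≡ everyVec m k q
everyVec-cong m zero    p≗q = p≗q []
everyVec-cong m (suc k) p≗q = everyFin-cong m (λ a → everyVec-cong m k (p≗q ∘ (a ∷_)))

everyVec-mono : ∀ m k {p q : Vec (Fin m) k → Bool} → (∀ v → p v ≡ true → q v ≡ true) →
                everyVec m k p ≡ true → everyVec m k q ≡ true
everyVec-mono m zero    p⇒q e = p⇒q [] e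
everyVec-mono m (suc k) p⇒q e =
  everyFin⁺ m _ (λ a → everyVec-mono m k (p⇒q ∘ (a ∷_)) (everyFin⁻ m _ e a))

subst-subst-irrelevant : ∀ {X : Set} (F : X → Set) {a b c : X}
                         (e₁ : a ≡ b) (e₂ : b ≡ c) (e₃ : a ≡ c) w →
                         subst F e₂ (subst F e₁ w) ≡ subst F e₃ w
subst-subst-irrelevant F refl refl refl w = refl

map-subst : ∀ {X Y : Set} (f : X → Y) {a b} (e : a ≡ b) (v : Vec X a) →
            map f (subst (Vec X) e v) ≡ subst (Vec Y) e (map f v)
map-subst f refl v = refl

vars : ∀ {σ : Vocab} m → Vec (Term σ m) m
vars m = tabulate var

eval-vars : ∀ {σ : Vocab} (A : Structure σ) {m} (s : Vec (Universe A) m) →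
            map (evalTerm A s) (vars m) ≡ s
eval-vars A s = trans (sym (tabulate-∘ (evalTerm A s) var)) (tabulate∘lookup s)

evalFO-subst : ∀ {σ : Vocab} (A : Structure σ) {a a′ : ℕ} (e : a ≡ a′)
               (v : Vec (Universe A) a) (φ : FO σ a) →
               evalFO A (subst (Vec (Universe A)) e v) (subst (FO σ) e φ) ≡ evalFO A v φ
evalFO-subst A refl v φ = refl

module _ {d : Dialect} {σ : Vocab} {nI : ℕ} {iar : Fin nI → ℕ} (A : Structure σ) where

  HeadIs : (ρ : Rule d σ nI iar) → Vec (Universe A) (Rule.nv ρ) →
           (P : Fin nI) → Vec (Universe A) (iar P) → Set
  HeadIs ρ s P ā = Σ (head ρ ≡ P) λ p → subst (Vec (Universe A) ∘ iar) p (map (lookup s) (hargs ρ)) ≡ ā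

  BodyHolds : Interp nI iar (Universe A) → (ρ : Rule d σ nI iar) → Vec (Universe A) (Rule.nv ρ) → Set
  BodyHolds J ρ s = All (λ l → evalLit A J s l ≡ true) (body ρ)

  record Derivation (J : Interp nI iar (Universe A)) (R : List (Rule d σ nI iar))
                    (P : Fin nI) (ā : Vec (Universe A) (iar P)) : Set where
    constructor derive
    field
      rule       : Rule d σ nI iar
      member     : rule ∈ R
      assignment : Vec (Universe A) (Rule.nv rule)
      head-is    : HeadIs rule assignment P ā
      body-holds : BodyHolds J rule assignment

  derivation-mono : ∀ {J R R′ P ā} → (∀ {ρ} → ρ ∈ R → ρ ∈ R′) → Derivation J R P ā → Derivation J R′ P ā
  derivation-mono R⊆R′ (derive ρ ρ∈R s hd bd) = derive ρ (R⊆R′ ρ∈R) s hd bd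

  head-is-elim : ∀ {ρ s P ā} (Q : (P : Fin nI) → Vec (Universe A) (iar P) → Set) →
                 HeadIs ρ s P ā → Q (head ρ) (map (lookup s) (hargs ρ)) → Q P ā
  head-is-elim Q (refl , refl) q = q

module _ {d : Dialect} {σ : Vocab} (Π : Program d σ) (A : Structure σ) where
  open Program Π

  matches⁻ : ∀ ρ P ā s → matches Π A ρ P ā s ≡ true → HeadIs A ρ s P ā
  matches⁻ ρ P ā s eq with head ρ ≟ P
  ... | yes refl = refl , toWitness (Equivalence.from T-≡ eq)
  matches⁻ ρ P ā s () | no _

  matches-self : ∀ ρ s → matches Π A ρ (head ρ) (map (lookup s) (hargs ρ)) s ≡ true
  matches-self ρ s with head ρ ≟ head ρ
  ... | yes refl = Equivalence.to T-≡ (fromWitness refl)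
  ... | no ≢     = ⊥-elim (≢ refl)

  stage-suc⁻ : ∀ i {P ā} → stage Π A (suc i) P ā ≡ true → Derivation A (stage Π A i) rules P ā
  stage-suc⁻ i {P} {ā} e with any-true⁻ _ rules e
  ... | ρ , ρ∈ , fires with someVec⁻ _ (Rule.nv ρ) _ fires
  ...   | s , holds with ∧-true⁻ _ holds
  ...     | matched , bd = derive ρ ρ∈ s (matches⁻ ρ P ā s matched) (all-true⁻ _ (body ρ) bd)

  stage-suc⁺ : ∀ i {P ā} → Derivation A (stage Π A i) rules P ā → stage Π A (suc i) P ā ≡ true
  stage-suc⁺ i (derive ρ ρ∈ s (refl , refl) bd) =
    any-true⁺ _ rules ρ∈ (someVec⁺ _ (Rule.nv ρ) _ s (∧-true⁺ (matches-self ρ s) (all-true⁺ _ (body ρ) bd)))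

-- Widening a dialect

⊑-trans : ∀ {d₁ d₂ d₃} → d₁ ⊑ d₂ → d₂ ⊑ d₃ → d₁ ⊑ d₃
⊑-trans d₁⊑d₂ d₂⊑d₃ σ r φ with d₁⊑d₂ σ r φ
... | ψ , φ⇔ψ with d₂⊑d₃ σ r ψ
...   | χ , ψ⇔χ = χ , λ A ā → mk⇔ (Equivalence.to (ψ⇔χ A ā) ∘ Equivalence.to (φ⇔ψ A ā))
                                  (Equivalence.from (φ⇔ψ A ā) ∘ Equivalence.from (ψ⇔χ A ā))

module Widening {d₁ d₂ : Dialect} (widenFO : T (allowsFO d₁) → T (allowsFO d₂))
                (widenAll : T (allowsForall d₁) → T (allowsForall d₂)) {σ : Vocab} where

  widenLit : ∀ {nI iar nv} → Lit d₁ σ nI iar nv → Lit d₂ σ nI iar nv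
  widenLit (posE R ts)         = posE R ts
  widenLit (negE R ts)         = negE R ts
  widenLit (eqA t u)           = eqA t u
  widenLit (neqA t u)          = neqA t u
  widenLit (posI P ts)         = posI P ts
  widenLit (foL t φ)           = foL (widenFO t) φ
  widenLit (allI t P k l e zs) = allI (widenAll t) P k l e zs

  widenRule : ∀ {nI iar} → Rule d₁ σ nI iar → Rule d₂ σ nI iar
  widenRule ρ = record { nv = Rule.nv ρ ; head = head ρ ; hargs = hargs ρ ; body = mapL widenLit (body ρ) }

  widenProgram : Program d₁ σ → Program d₂ σ
  widenProgram Π = record
    { nI = Program.nI Π ; iar = Program.iar Π ; rules = mapL widenRule (Program.rules Π)
    ; headed = λ P → AnyP.map⁺ (Program.headed Π P) }

  module _ (Π : Program d₁ σ) (A : Structure σ) where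
    open Program Π

    evalLit-widen : ∀ {nv} {J J′ : Interp nI iar (Universe A)} → (∀ P v → J′ P v ≡ J P v) →
                    (s : Vec (Universe A) nv) (l : Lit d₁ σ nI iar nv) →
                    evalLit A J′ s (widenLit l) ≡ evalLit A J s l
    evalLit-widen J′≗J s (posE R ts)         = refl
    evalLit-widen J′≗J s (negE R ts)         = refl
    evalLit-widen J′≗J s (eqA t u)           = refl
    evalLit-widen J′≗J s (neqA t u)          = refl
    evalLit-widen J′≗J s (posI P ts)         = J′≗J P _
    evalLit-widen J′≗J s (foL t φ)           = refl
    evalLit-widen J′≗J s (allI t P k l e zs) = everyVec-cong _ k (λ _ → J′≗J P _)

    matches-widen : ∀ ρ P ā s → matches (widenProgram Π) A (widenRule ρ) P ā s ≡ matches Π A ρ P ā s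
    matches-widen ρ P ā s with head ρ ≟ P
    ... | yes refl = refl
    ... | no _     = refl

    stage-widen : ∀ i P ā → stage (widenProgram Π) A i P ā ≡ stage Π A i P ā
    stage-widen zero    P ā = refl
    stage-widen (suc i) P ā = any-map (λ ρ → someVec-cong _ (Rule.nv ρ) (λ s →
      cong₂ _∧_ (matches-widen ρ P ā s) (all-map (evalLit-widen (stage-widen i) s) (body ρ)))) rules

widen⊑ : ∀ {d₁ d₂} → (T (allowsFO d₁) → T (allowsFO d₂)) →
         (T (allowsForall d₁) → T (allowsForall d₂)) → d₁ ⊑ d₂
widen⊑ widenFO widenAll σ r φ =
  ψ , λ A ā → mk⇔ (λ (i , h) → i , trans (stage-widen prog A i _ _) h)
                  (λ (i , h) → i , trans (sym (stage-widen prog A i _ _)) h)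
  where
    open DFormula φ
    open Widening widenFO widenAll
    ψ : DFormula _ σ r
    ψ = record { prog = widenProgram prog ; goal = goal ; goalAr = goalAr }

weakenLit : ∀ {d σ n m nv} {ar : Fin n → ℕ} → Lit d σ n ar nv → Lit d σ (suc n) (m VF.∷ ar) nv
weakenLit (posE R ts)         = posE R ts
weakenLit (negE R ts)         = negE R ts
weakenLit (eqA t u)           = eqA t u
weakenLit (neqA t u)          = neqA t u
weakenLit (posI P ts)         = posI (suc P) ts
weakenLit (foL t φ)           = foL t φ
weakenLit (allI t P k l e zs) = allI t (suc P) k l e zs

weakenRule : ∀ {d σ n m} {ar : Fin n → ℕ} → Rule d σ n ar → Rule d σ (suc n) (m VF.∷ ar)
weakenRule ρ = record
  { nv = Rule.nv ρ ; head = suc (head ρ) ; hargs = hargs ρ ; body = mapL weakenLit (body ρ) }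

module _ {d : Dialect} {σ : Vocab} {n m : ℕ} {ar : Fin n → ℕ}
         (A : Structure σ) (J : Interp (suc n) (m VF.∷ ar) (Universe A)) where

  evalLit-weaken : ∀ {nv} (s : Vec (Universe A) nv) (l : Lit d σ n ar nv) →
                   evalLit A J s (weakenLit l) ≡ evalLit A (λ P → J (suc P)) s l
  evalLit-weaken s (posE R ts)         = refl
  evalLit-weaken s (negE R ts)         = refl
  evalLit-weaken s (eqA t u)           = refl
  evalLit-weaken s (neqA t u)          = refl
  evalLit-weaken s (posI P ts)         = refl
  evalLit-weaken s (foL t φ)           = refl
  evalLit-weaken s (allI t P k l e zs) = refl

  derivation-weaken : ∀ {R y v} → Derivation A (λ P → J (suc P)) R y v →
                      Derivation A J (mapL weakenRule R) (suc y) v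
  derivation-weaken (derive ρ ρ∈R s (refl , refl) bd) =
    derive (weakenRule ρ) (∈-map⁺ weakenRule ρ∈R) s (refl , refl)
           (AllP.map⁺ (All.map (λ {l} → trans (evalLit-weaken s l)) bd))

-- Eliminating first-order body formulas

module Translation {σ : Vocab} (Π : Program DATALOG*ʳ σ) where
  open Program Π renaming (nI to nO; iar to arO; rules to rulesO; headed to headedO)

  -- A symbol with role evaluates b φ is to hold of v exactly when φ evaluates to b at v.
  data Role (a : ℕ) : Set where
    original  : (P : Fin nO) → a ≡ arO P → Role a
    evaluates : Bool → FO σ a → Role a

  original≢evaluates : ∀ {a} {r : Role a} {P e b φ} → r ≡ original P e → r ≡ evaluates b φ → ⊥
  original≢evaluates refl ()

  -- The rules of an auxiliary symbol mention only symbols of smaller level.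
  record Signature : Set where
    field
      size         : ℕ
      arity        : Fin size → ℕ
      role         : (x : Fin size) → Role (arity x)
      level        : Fin size → ℕ
      height       : ℕ
      level<height : ∀ x → level x < height
      embed        : Fin nO → Fin size
      arity-embed  : ∀ P → arity (embed P) ≡ arO P
      role-embed   : ∀ P → role (embed P) ≡ original P (arity-embed P)
      embed-onto   : ∀ x {P e} → role x ≡ original P e → embed P ≡ x

  open Signature

  SLit : Signature → ℕ → Set
  SLit S = Lit DATALOGʳ σ (size S) (arity S)

  SRule : Signature → Set
  SRule S = Rule DATALOGʳ σ (size S) (arity S)

  SInterp : Signature → Set → Set
  SInterp S = Interp (size S) (arity S)

  record Handle (S : Signature) (m : ℕ) (b : Bool) (ψ : FO σ m) : Set where
    constructor handle
    field
      symbol : Fin (size S)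
      arity≡ : arity S symbol ≡ m
      role≡  : role S symbol ≡ evaluates b (subst (FO σ) (sym arity≡) ψ)

  open Handle

  Lift : Signature → Signature → Set
  Lift S S′ = ∀ {m b ψ} → Handle S m b ψ → Handle S′ m b ψ

  atom : ∀ {S m b ψ} → Handle S m b ψ → SLit S m
  atom {m = m} h = posI (symbol h) (subst (Vec (Term σ m)) (sym (arity≡ h)) (vars m))

  forallAtom : ∀ {S m b ψ} → Handle S (suc m) b ψ → SLit S m
  forallAtom {m = m} h = allI tt (symbol h) 1 m (sym (arity≡ h)) (allFin m)

  _⟪_⟫ : ∀ {S m b ψ} {U : Set} → SInterp S U → Handle S m b ψ → Vec U m → Bool
  (J ⟪ h ⟫) v = J (symbol h) (subst (Vec _) (sym (arity≡ h)) v)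

  module _ (S : Signature) (A : Structure σ) where

    FaithfulAt : (x : Fin (size S)) → Vec (Universe A) (arity S x) → Set
    FaithfulAt x v = ∀ {b φ} → role S x ≡ evaluates b φ → evalFO A v φ ≡ b

    Faithful : SInterp S (Universe A) → Set
    Faithful J = ∀ x v → J x v ≡ true → FaithfulAt x v

    CompleteBelow : SInterp S (Universe A) → ℕ → Set
    CompleteBelow J d = ∀ x {b φ} → role S x ≡ evaluates b φ → level S x < d →
                        ∀ v → evalFO A v φ ≡ b → J x v ≡ true

    CompleteBelow-mono : ∀ {J d d′} → d ≤ d′ → CompleteBelow J d′ → CompleteBelow J d
    CompleteBelow-mono d≤d′ complete x r x<d = complete x r (<-≤-trans x<d d≤d′)

  module _ {S : Signature} (A : Structure σ) {J : SInterp S (Universe A)} {m b ψ} (h : Handle S m b ψ) where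

    handle-sound : Faithful S A J → ∀ v → (J ⟪ h ⟫) v ≡ true → evalFO A v ψ ≡ b
    handle-sound faithful v Jv =
      trans (sym (evalFO-subst A (sym (arity≡ h)) v ψ)) (faithful (symbol h) _ Jv (role≡ h))

    handle-complete : ∀ {d} → CompleteBelow S A J d → level S (symbol h) < d →
                      ∀ v → evalFO A v ψ ≡ b → (J ⟪ h ⟫) v ≡ true
    handle-complete complete h<d v ψv =
      complete (symbol h) (role≡ h) h<d _ (trans (evalFO-subst A (sym (arity≡ h)) v ψ) ψv)

    eval-atom : ∀ s → evalLit A J s (atom h) ≡ (J ⟪ h ⟫) s
    eval-atom s = cong (J (symbol h)) (begin
      map (evalTerm A s) (subst (Vec (Term σ m)) (sym (arity≡ h)) (vars m))
        ≡⟨ map-subst (evalTerm A s) (sym (arity≡ h)) (vars m) ⟩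
      subst (Vec (Universe A)) (sym (arity≡ h)) (map (evalTerm A s) (vars m))
        ≡⟨ cong (subst (Vec (Universe A)) (sym (arity≡ h))) (eval-vars A s) ⟩
      subst (Vec (Universe A)) (sym (arity≡ h)) s ∎)
      where open ≡-Reasoning

    atom-sound : Faithful S A J → ∀ s → evalLit A J s (atom h) ≡ true → evalFO A s ψ ≡ b
    atom-sound faithful s holds = handle-sound faithful s (trans (sym (eval-atom s)) holds)

    atom-complete : ∀ {d} → CompleteBelow S A J d → level S (symbol h) < d →
                    ∀ s → evalFO A s ψ ≡ b → evalLit A J s (atom h) ≡ true
    atom-complete complete h<d s ψs = trans (eval-atom s) (handle-complete complete h<d s ψs)

  record AuxiliaryRules (S : Signature) : Set where
    field
      rules    : List (SRule S)
      head-aux : ∀ {ρ} → ρ ∈ rules → ∃₂ λ b φ → role S (head ρ) ≡ evaluates b φ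
      headed   : ∀ x {b φ} → role S x ≡ evaluates b φ → Any (λ ρ → head ρ ≡ x) rules
      sound    : ∀ {ρ} → ρ ∈ rules → ∀ A J s → Faithful S A J → BodyHolds A J ρ s →
                 FaithfulAt S A (head ρ) (map (lookup s) (hargs ρ))
      complete : ∀ x {b φ} → role S x ≡ evaluates b φ → ∀ A J → CompleteBelow S A J (level S x) →
                 ∀ v → evalFO A v φ ≡ b → Derivation A J rules x v

  consRole : ∀ {n m} {ar : Fin n → ℕ} → Role m → ((x : Fin n) → Role (ar x)) →
             (x : Fin (suc n)) → Role ((m VF.∷ ar) x)
  consRole r rs zero    = r
  consRole r rs (suc x) = rs x

  extend : Signature → (m : ℕ) → Bool → FO σ m → Signature
  extend S m b ψ = record
    { size = suc (size S) ; arity = m VF.∷ arity S ; role = consRole (evaluates b ψ) (role S)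
    ; level = height S VF.∷ level S ; height = suc (height S) ; level<height = level<height′
    ; embed = suc ∘ embed S ; arity-embed = arity-embed S ; role-embed = role-embed S
    ; embed-onto = embed-onto′ }
    where
      level<height′ : ∀ x → (height S VF.∷ level S) x < suc (height S)
      level<height′ zero    = ≤-refl
      level<height′ (suc x) = m<n⇒m<1+n (level<height S x)
      embed-onto′ : ∀ x {P e} → consRole (evaluates b ψ) (role S) x ≡ original P e → suc (embed S P) ≡ x
      embed-onto′ zero    ()
      embed-onto′ (suc x) r = cong suc (embed-onto S x r)

  module Extend (S : Signature) (m : ℕ) (b : Bool) (ψ : FO σ m) where

    S′ : Signature
    S′ = extend S m b ψ

    lift : Lift S S′
    lift h = handle (suc (symbol h)) (arity≡ h) (role≡ h)

    new : Handle S′ m b ψ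
    new = handle zero refl refl

    record Clause : Set where
      constructor clause
      field
        nv   : ℕ
        args : Vec (Fin nv) m
        lits : List (SLit S′ nv)

    toRule : Clause → SRule S′
    toRule c = record { nv = Clause.nv c ; head = zero ; hargs = Clause.args c ; body = Clause.lits c }

    ClauseSound : Clause → Set
    ClauseSound c = ∀ A J s → Faithful S′ A J → BodyHolds A J (toRule c) s →
                    evalFO A (map (lookup s) (Clause.args c)) ψ ≡ b

    Covers : List Clause → Set
    Covers cs = ∀ A J → CompleteBelow S′ A J (height S) → ∀ v → evalFO A v ψ ≡ b →
                Derivation A J (mapL toRule cs) zero v

    direct : List (SLit S′ m) → Clause
    direct = clause m (allFin m)

    direct-sound : ∀ {ls} → (∀ A J v → Faithful S′ A J → BodyHolds A J (toRule (direct ls)) v →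
                             evalFO A v ψ ≡ b) →
                   ClauseSound (direct ls)
    direct-sound sound A J s faithful bd =
      subst (λ w → evalFO A w ψ ≡ b) (sym (map-lookup-allFin s)) (sound A J s faithful bd)

    derive-direct : ∀ {A J R ls v} → toRule (direct ls) ∈ R → BodyHolds A J (toRule (direct ls)) v →
                    Derivation A J R zero v
    derive-direct {v = v} mem bd = derive _ mem v (refl , map-lookup-allFin v) bd

    lifted-sound : ∀ {A J m′ b′ φ′} → Faithful S′ A J → (h : Handle S m′ b′ φ′) →
                   ∀ v → evalLit A J v (atom (lift h)) ≡ true → evalFO A v φ′ ≡ b′
    lifted-sound {A} faithful h = atom-sound A (lift h) faithful

    lifted-complete : ∀ {A J m′ b′ φ′} → CompleteBelow S′ A J (height S) → (h : Handle S m′ b′ φ′) →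
                      ∀ v → evalFO A v φ′ ≡ b′ → evalLit A J v (atom (lift h)) ≡ true
    lifted-complete {A} complete h = atom-complete A (lift h) complete (level<height S (symbol h))

    module _ (B : AuxiliaryRules S) where
      open AuxiliaryRules B

      addSymbol : (c : Clause) (cs : List Clause) → All ClauseSound (c ∷ cs) → Covers (c ∷ cs) →
                  AuxiliaryRules S′
      addSymbol c cs sound₀ complete₀ = record
        { rules = newRules ++L oldRules ; head-aux = head-aux′ ; headed = headed′
        ; sound = sound′ ; complete = complete′ }
        where
          newRules = mapL toRule (c ∷ cs)
          oldRules = mapL weakenRule rules

          head-aux′ : ∀ {ρ} → ρ ∈ newRules ++L oldRules → ∃₂ λ b′ φ → role S′ (head ρ) ≡ evaluates b′ φ
          head-aux′ ρ∈ with ∈-++⁻ newRules ρ∈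
          ... | inj₁ ρ∈new with ∈-map⁻ toRule ρ∈new
          ...   | _ , _ , refl = b , ψ , refl
          head-aux′ ρ∈ | inj₂ ρ∈old with ∈-map⁻ weakenRule ρ∈old
          ...   | _ , ρ₀∈ , refl = head-aux ρ₀∈

          headed′ : ∀ x {b′ φ} → role S′ x ≡ evaluates b′ φ → Any (λ ρ → head ρ ≡ x) (newRules ++L oldRules)
          headed′ zero    _ = here refl
          headed′ (suc x) r = AnyP.++⁺ʳ newRules (AnyP.map⁺ (Any.map (cong suc) (headed x r)))

          sound′ : ∀ {ρ} → ρ ∈ newRules ++L oldRules → ∀ A J s → Faithful S′ A J → BodyHolds A J ρ s →
                   FaithfulAt S′ A (head ρ) (map (lookup s) (hargs ρ))
          sound′ ρ∈ A J s faithful bd with ∈-++⁻ newRules ρ∈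
          ... | inj₁ ρ∈new with ∈-map⁻ toRule ρ∈new
          ...   | c′ , c′∈ , refl = λ { refl → All.lookup sound₀ c′∈ A J s faithful bd }
          sound′ ρ∈ A J s faithful bd | inj₂ ρ∈old with ∈-map⁻ weakenRule ρ∈old
          ...   | ρ₀ , ρ₀∈ , refl =
            sound ρ₀∈ A (λ P → J (suc P)) s (λ x → faithful (suc x))
                  (All.map (λ {l} → trans (sym (evalLit-weaken A J s l))) (AllP.map⁻ bd))

          complete′ : ∀ x {b′ φ} → role S′ x ≡ evaluates b′ φ → ∀ A J → CompleteBelow S′ A J (level S′ x) →
                      ∀ v → evalFO A v φ ≡ b′ → Derivation A J (newRules ++L oldRules) x v
          complete′ zero    refl A J below v ψv = derivation-mono A ∈-++⁺ˡ (complete₀ A J below v ψv)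
          complete′ (suc x) r    A J below v φv =
            derivation-mono A (∈-++⁺ʳ newRules)
              (derivation-weaken A J (complete x r A (λ P → J (suc P)) (λ y → below (suc y)) v φv))

      literal : (l : SLit S′ m) → (∀ A J v → evalLit A J v l ≡ true → evalFO A v ψ ≡ b) →
                (∀ A J v → evalFO A v ψ ≡ b → evalLit A J v l ≡ true) → AuxiliaryRules S′
      literal l sound₁ complete₁ = addSymbol (direct (l ∷ [])) []
        (direct-sound (λ A J v _ bd → sound₁ A J v (All.head bd)) ∷ [])
        (λ A J _ v ψv → derive-direct (here refl) (complete₁ A J v ψv ∷ []))

      copy : ∀ {b₁ φ₁} (h : Handle S m b₁ φ₁) →
             (∀ A v → evalFO A v φ₁ ≡ b₁ → evalFO A v ψ ≡ b) →
             (∀ A v → evalFO A v ψ ≡ b → evalFO A v φ₁ ≡ b₁) → AuxiliaryRules S′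
      copy h sound₁ complete₁ = addSymbol (direct (atom (lift h) ∷ [])) []
        (direct-sound (λ A J v faithful bd → sound₁ A v (lifted-sound faithful h v (All.head bd))) ∷ [])
        (λ A J below v ψv → derive-direct (here refl) (lifted-complete below h v (complete₁ A v ψv) ∷ []))

      conjunction : ∀ {b₁ φ₁ b₂ φ₂} (h₁ : Handle S m b₁ φ₁) (h₂ : Handle S m b₂ φ₂) →
                    (∀ A v → evalFO A v φ₁ ≡ b₁ → evalFO A v φ₂ ≡ b₂ → evalFO A v ψ ≡ b) →
                    (∀ A v → evalFO A v ψ ≡ b → evalFO A v φ₁ ≡ b₁ × evalFO A v φ₂ ≡ b₂) →
                    AuxiliaryRules S′
      conjunction h₁ h₂ sound₂ complete₂ = addSymbol both [] (direct-sound sound₀ ∷ []) complete₀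
        where
          both = direct (atom (lift h₁) ∷ atom (lift h₂) ∷ [])
          sound₀ : ∀ A J v → Faithful S′ A J → BodyHolds A J (toRule both) v → evalFO A v ψ ≡ b
          sound₀ A J v faithful (t₁ ∷ t₂ ∷ []) =
            sound₂ A v (lifted-sound faithful h₁ v t₁) (lifted-sound faithful h₂ v t₂)
          complete₀ : Covers (both ∷ [])
          complete₀ A J below v ψv with complete₂ A v ψv
          ... | φ₁v , φ₂v = derive-direct (here refl)
            (lifted-complete below h₁ v φ₁v ∷ lifted-complete below h₂ v φ₂v ∷ [])

      disjunction : ∀ {b₁ φ₁ b₂ φ₂} (h₁ : Handle S m b₁ φ₁) (h₂ : Handle S m b₂ φ₂) →
                    (∀ A v → evalFO A v φ₁ ≡ b₁ → evalFO A v ψ ≡ b) →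
                    (∀ A v → evalFO A v φ₂ ≡ b₂ → evalFO A v ψ ≡ b) →
                    (∀ A v → evalFO A v ψ ≡ b → evalFO A v φ₁ ≡ b₁ ⊎ evalFO A v φ₂ ≡ b₂) →
                    AuxiliaryRules S′
      disjunction h₁ h₂ sound₁ sound₂ complete₂ = addSymbol (via h₁) (via h₂ ∷ [])
        (direct-sound (via-sound h₁ sound₁) ∷ direct-sound (via-sound h₂ sound₂) ∷ []) complete₀
        where
          via : ∀ {b′ φ′} → Handle S m b′ φ′ → Clause
          via h = direct (atom (lift h) ∷ [])
          via-sound : ∀ {b′ φ′} (h : Handle S m b′ φ′) → (∀ A v → evalFO A v φ′ ≡ b′ → evalFO A v ψ ≡ b) →
                      ∀ A J v → Faithful S′ A J → BodyHolds A J (toRule (via h)) v → evalFO A v ψ ≡ b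
          via-sound h sound A J v faithful bd = sound A v (lifted-sound faithful h v (All.head bd))
          complete₀ : Covers (via h₁ ∷ via h₂ ∷ [])
          complete₀ A J below v ψv with complete₂ A v ψv
          ... | inj₁ φ₁v = derive-direct (here refl) (lifted-complete below h₁ v φ₁v ∷ [])
          ... | inj₂ φ₂v = derive-direct (there (here refl)) (lifted-complete below h₂ v φ₂v ∷ [])

      existential : ∀ {b₁ φ₁} (h : Handle S (suc m) b₁ φ₁) →
                    (∀ A v a → evalFO A (a ∷ v) φ₁ ≡ b₁ → evalFO A v ψ ≡ b) →
                    (∀ A v → evalFO A v ψ ≡ b → ∃ λ a → evalFO A (a ∷ v) φ₁ ≡ b₁) → AuxiliaryRules S′
      existential h sound₁ complete₁ = addSymbol witness [] (sound₀ ∷ []) complete₀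
        where
          witness = clause (suc m) (tabulate suc) (atom (lift h) ∷ [])
          forget-witness : ∀ {X : Set} (a : X) (v : Vec X m) → map (lookup (a ∷ v)) (tabulate suc) ≡ v
          forget-witness a v = trans (sym (tabulate-∘ (lookup (a ∷ v)) suc)) (tabulate∘lookup v)
          sound₀ : ClauseSound witness
          sound₀ A J (a ∷ v) faithful bd =
            subst (λ w → evalFO A w ψ ≡ b) (sym (forget-witness a v))
              (sound₁ A v a (lifted-sound faithful h (a ∷ v) (All.head bd)))
          complete₀ : Covers (witness ∷ [])
          complete₀ A J below v ψv with complete₁ A v ψv
          ... | a , φ₁av = derive _ (here refl) (a ∷ v) (refl , forget-witness a v)
                                  (lifted-complete below h (a ∷ v) φ₁av ∷ [])

      universal : ∀ {b₁ φ₁} (h : Handle S (suc m) b₁ φ₁) →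
                  (∀ A v → (∀ a → evalFO A (a ∷ v) φ₁ ≡ b₁) → evalFO A v ψ ≡ b) →
                  (∀ A v → evalFO A v ψ ≡ b → ∀ a → evalFO A (a ∷ v) φ₁ ≡ b₁) → AuxiliaryRules S′
      universal {b₁} {φ₁} h sound₁ complete₁ = addSymbol every [] (direct-sound sound₀ ∷ []) complete₀
        where
          every = direct (forallAtom (lift h) ∷ [])
          atEvery : ∀ {U : Set} → SInterp S′ U → Vec U m → U → Bool
          atEvery J v a = (J ⟪ lift h ⟫) (a ∷ map (lookup v) (allFin m))
          sound₀ : ∀ A J v → Faithful S′ A J → BodyHolds A J (toRule every) v → evalFO A v ψ ≡ b
          sound₀ A J v faithful bd = sound₁ A v λ a →
            subst (λ w → evalFO A (a ∷ w) φ₁ ≡ b₁) (map-lookup-allFin v)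
              (handle-sound A (lift h) faithful _ (everyFin⁻ _ (atEvery J v) (All.head bd) a))
          complete₀ : Covers (every ∷ [])
          complete₀ A J below v ψv = derive-direct (here refl) (everyFin⁺ _ (atEvery J v) (λ a →
            subst (λ w → (J ⟪ lift h ⟫) (a ∷ w) ≡ true) (sym (map-lookup-allFin v))
              (handle-complete A (lift h) below (level<height S (symbol h)) (a ∷ v) (complete₁ A v ψv a))) ∷ [])

  record Extension (S : Signature) (X : Signature → Set) : Set where
    constructor extension
    field
      sig   : Signature
      aux   : AuxiliaryRules sig
      lift  : Lift S sig
      value : X sig

  unchanged : ∀ {S} {X : Signature → Set} → AuxiliaryRules S → X S → Extension S X
  unchanged B x = extension _ B (λ h → h) x

  mapValue : ∀ {S} {X Y : Signature → Set} → (∀ {S′} → X S′ → Y S′) → Extension S X → Extension S Y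
  mapValue f (extension S₁ B₁ L₁ x) = extension S₁ B₁ L₁ (f x)

  extendBoth : ∀ {S} {X Y : Signature → Set} → (∀ {S₁ S₂} → Lift S₁ S₂ → X S₁ → X S₂) →
               Extension S X → ((S₁ : Signature) → AuxiliaryRules S₁ → Extension S₁ Y) →
               Extension S (λ S′ → X S′ × Y S′)
  extendBoth liftX (extension S₁ B₁ L₁ x) next with next S₁ B₁
  ... | extension S₂ B₂ L₂ y = extension S₂ B₂ (λ h → L₂ (L₁ h)) (liftX L₂ x , y)

  define : ∀ {S X m b ψ} → Extension S X →
           ((S₁ : Signature) → AuxiliaryRules S₁ → X S₁ → AuxiliaryRules (extend S₁ m b ψ)) →
           Extension S (λ S′ → Handle S′ m b ψ)
  define {m = m} {b} {ψ} (extension S₁ B₁ L₁ x) node =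
    extension (extend S₁ m b ψ) (node S₁ B₁ x) (λ h → Extend.lift S₁ m b ψ (L₁ h)) (Extend.new S₁ m b ψ)

  defineLiteral : ∀ {S m b ψ} → AuxiliaryRules S → (l : SLit (extend S m b ψ) m) →
                  (∀ A J v → evalLit A J v l ≡ true → evalFO A v ψ ≡ b) →
                  (∀ A J v → evalFO A v ψ ≡ b → evalLit A J v l ≡ true) →
                  Extension S (λ S′ → Handle S′ m b ψ)
  defineLiteral {S} {m} {b} {ψ} B l sound complete =
    extension (extend S m b ψ) (Extend.literal S m b ψ B l sound complete)
              (Extend.lift S m b ψ) (Extend.new S m b ψ)

  mutual
    compile : (S : Signature) → AuxiliaryRules S → (m : ℕ) (b : Bool) (ψ : FO σ m) →
              Extension S (λ S′ → Handle S′ m b ψ)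
    compile S B m true  (t ≐ u)    = defineLiteral B (eqA t u) (λ _ _ _ → id) (λ _ _ _ → id)
    compile S B m false (t ≐ u)    =
      defineLiteral B (neqA t u) (λ _ _ _ → not-transpose) (λ _ _ _ → not-transpose⁻ true)
    compile S B m true  (rel R ts) = defineLiteral B (posE R ts) (λ _ _ _ → id) (λ _ _ _ → id)
    compile S B m false (rel R ts) =
      defineLiteral B (negE R ts) (λ _ _ _ → not-transpose) (λ _ _ _ → not-transpose⁻ true)
    compile S B m b (¬' φ) = define (compile S B m (not b) φ) λ S₁ B₁ h →
      Extend.copy S₁ m b (¬' φ) B₁ h (λ _ _ → not-transpose⁻ b) (λ _ _ → not-transpose)
    compile S B m true (φ₁ ∧' φ₂) = define (compile₂ S B m true φ₁ true φ₂) λ S₁ B₁ (h₁ , h₂) →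
      Extend.conjunction S₁ m true (φ₁ ∧' φ₂) B₁ h₁ h₂ (λ _ _ → ∧-true⁺) (λ _ _ → ∧-true⁻ _)
    compile S B m false (φ₁ ∧' φ₂) = define (compile₂ S B m false φ₁ false φ₂) λ S₁ B₁ (h₁ , h₂) →
      Extend.disjunction S₁ m false (φ₁ ∧' φ₂) B₁ h₁ h₂
        (λ _ _ → ∧-falseˡ _) (λ _ _ → ∧-falseʳ _) (λ _ _ → ∧-false⁻ _)
    compile S B m true (φ₁ ∨' φ₂) = define (compile₂ S B m true φ₁ true φ₂) λ S₁ B₁ (h₁ , h₂) →
      Extend.disjunction S₁ m true (φ₁ ∨' φ₂) B₁ h₁ h₂
        (λ _ _ → ∨-trueˡ _) (λ _ _ → ∨-trueʳ _) (λ _ _ → ∨-true⁻ _)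
    compile S B m false (φ₁ ∨' φ₂) = define (compile₂ S B m false φ₁ false φ₂) λ S₁ B₁ (h₁ , h₂) →
      Extend.conjunction S₁ m false (φ₁ ∨' φ₂) B₁ h₁ h₂ (λ _ _ → ∨-false⁺) (λ _ _ → ∨-false⁻ _)
    compile S B m true (∃' φ) = define (compile S B (suc m) true φ) λ S₁ B₁ h →
      Extend.existential S₁ m true (∃' φ) B₁ h (λ _ _ → someFin⁺ _ _) (λ _ _ → someFin⁻ _ _)
    compile S B m false (∃' φ) = define (compile S B (suc m) false φ) λ S₁ B₁ h →
      Extend.universal S₁ m false (∃' φ) B₁ h (λ _ _ → someFin-false⁺ _ _) (λ _ _ → someFin-false⁻ _ _)
    compile S B m true (∀' φ) = define (compile S B (suc m) true φ) λ S₁ B₁ h →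
      Extend.universal S₁ m true (∀' φ) B₁ h (λ _ _ → everyFin⁺ _ _) (λ _ _ → everyFin⁻ _ _)
    compile S B m false (∀' φ) = define (compile S B (suc m) false φ) λ S₁ B₁ h →
      Extend.existential S₁ m false (∀' φ) B₁ h (λ _ _ → everyFin-false⁺ _ _) (λ _ _ → everyFin-false⁻ _ _)

    compile₂ : (S : Signature) → AuxiliaryRules S →
               (m : ℕ) (b₁ : Bool) (φ₁ : FO σ m) (b₂ : Bool) (φ₂ : FO σ m) →
               Extension S (λ S′ → Handle S′ m b₁ φ₁ × Handle S′ m b₂ φ₂)
    compile₂ S B m b₁ φ₁ b₂ φ₂ =
      extendBoth (λ L → L) (compile S B m b₁ φ₁) (λ S₁ B₁ → compile S₁ B₁ m b₂ φ₂)

  LitO : ℕ → Set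
  LitO = Lit DATALOG*ʳ σ nO arO

  RuleO : Set
  RuleO = Rule DATALOG*ʳ σ nO arO

  formulaOf : ∀ {nv} → LitO nv → Maybe (FO σ nv)
  formulaOf (foL _ φ) = just φ
  formulaOf _         = nothing

  FOHandles : Signature → ∀ {nv} → LitO nv → Set
  FOHandles S {nv} l = Maybe.All (Handle S nv true) (formulaOf l)

  BodyHandles : Signature → RuleO → Set
  BodyHandles S ρ = All (FOHandles S) (body ρ)

  compileLit : (S : Signature) → AuxiliaryRules S → ∀ {nv} (l : LitO nv) → Extension S (λ S′ → FOHandles S′ l)
  compileLit S B l with formulaOf l
  ... | nothing = unchanged B Maybe.nothing
  ... | just φ  = mapValue Maybe.just (compile S B _ true φ)

  compileLits : (S : Signature) → AuxiliaryRules S → ∀ {nv} (ls : List (LitO nv)) →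
                Extension S (λ S′ → All (FOHandles S′) ls)
  compileLits S B []       = unchanged B []
  compileLits S B (l ∷ ls) = mapValue (λ (h , hs) → h ∷ hs)
    (extendBoth (λ L → Maybe.map L) (compileLit S B l) (λ S₁ B₁ → compileLits S₁ B₁ ls))

  compileRules : (S : Signature) → AuxiliaryRules S → (rs : List RuleO) →
                 Extension S (λ S′ → All (BodyHandles S′) rs)
  compileRules S B []       = unchanged B []
  compileRules S B (ρ ∷ rs) = mapValue (λ (hs , hss) → hs ∷ hss)
    (extendBoth (λ L → All.map (Maybe.map L)) (compileLits S B (body ρ)) (λ S₁ B₁ → compileRules S₁ B₁ rs))

  originalSignature : Signature
  originalSignature = record
    { size = nO ; arity = arO ; role = λ P → original P refl ; level = λ _ → 0 ; height = 1
    ; level<height = λ _ → s≤s z≤n ; embed = id ; arity-embed = λ _ → refl ; role-embed = λ _ → refl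
    ; embed-onto = onto }
    where
      onto : ∀ x {P e} → original {arO x} x refl ≡ original P e → P ≡ x
      onto x refl = refl

  noAuxiliaryRules : AuxiliaryRules originalSignature
  noAuxiliaryRules = record
    { rules = [] ; head-aux = λ () ; headed = λ _ () ; sound = λ () ; complete = λ _ () }

  compiled : Extension originalSignature (λ S′ → All (BodyHandles S′) rulesO)
  compiled = compileRules originalSignature noAuxiliaryRules rulesO

  S* : Signature
  S* = Extension.sig compiled

  B* : AuxiliaryRules S*
  B* = Extension.aux compiled

  handles* : All (BodyHandles S*) rulesO
  handles* = Extension.value compiled

  translateLit : ∀ {nv} (l : LitO nv) → FOHandles S* l → SLit S* nv
  translateLit (posE R ts)         _              = posE R ts
  translateLit (negE R ts)         _              = negE R ts
  translateLit (eqA t u)           _              = eqA t u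
  translateLit (neqA t u)          _              = neqA t u
  translateLit {nv} (posI P ts)    _              =
    posI (embed S* P) (subst (Vec (Term σ nv)) (sym (arity-embed S* P)) ts)
  translateLit (foL _ φ)           (Maybe.just h) = atom h
  translateLit (allI _ P k l e zs) _              =
    allI tt (embed S* P) k l (trans e (sym (arity-embed S* P))) zs

  translateLits : ∀ {nv} (ls : List (LitO nv)) → All (FOHandles S*) ls → List (SLit S* nv)
  translateLits []       []       = []
  translateLits (l ∷ ls) (h ∷ hs) = translateLit l h ∷ translateLits ls hs

  translateRule : (ρ : RuleO) → BodyHandles S* ρ → SRule S*
  translateRule ρ hs = record
    { nv = Rule.nv ρ ; head = embed S* (head ρ)
    ; hargs = subst (Vec (Fin (Rule.nv ρ))) (sym (arity-embed S* (head ρ))) (hargs ρ)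
    ; body = translateLits (body ρ) hs }

  translateRules : (rs : List RuleO) → All (BodyHandles S*) rs → List (SRule S*)
  translateRules []       []         = []
  translateRules (ρ ∷ rs) (hs ∷ hss) = translateRule ρ hs ∷ translateRules rs hss

  translateRules⁻ : ∀ rs hss {ρ} → ρ ∈ translateRules rs hss →
                    ∃ λ ρ₀ → ρ₀ ∈ rs × ∃ λ hs → ρ ≡ translateRule ρ₀ hs
  translateRules⁻ (ρ₀ ∷ rs) (hs ∷ hss) (here eq) = ρ₀ , here refl , hs , eq
  translateRules⁻ (ρ₀ ∷ rs) (hs ∷ hss) (there ρ∈) with translateRules⁻ rs hss ρ∈
  ... | ρ₁ , ρ₁∈ , hs₁ , eq = ρ₁ , there ρ₁∈ , hs₁ , eq

  translateRules⁺ : ∀ rs hss {ρ₀} (ρ₀∈ : ρ₀ ∈ rs) →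
                    translateRule ρ₀ (All.lookup hss ρ₀∈) ∈ translateRules rs hss
  translateRules⁺ (ρ ∷ rs) (hs ∷ hss) (here refl) = here refl
  translateRules⁺ (ρ ∷ rs) (hs ∷ hss) (there ρ₀∈) = there (translateRules⁺ rs hss ρ₀∈)

  translateRules-headed : ∀ rs hss {P} → Any (λ ρ → head ρ ≡ P) rs →
                          Any (λ ρ → head ρ ≡ embed S* P) (translateRules rs hss)
  translateRules-headed (ρ ∷ rs) (hs ∷ hss) (here eq) = here (cong (embed S*) eq)
  translateRules-headed (ρ ∷ rs) (hs ∷ hss) (there a) = there (translateRules-headed rs hss a)

  targetRules : List (SRule S*)
  targetRules = translateRules rulesO handles* ++L AuxiliaryRules.rules B*

  target : Program DATALOGʳ σ
  target = record
    { nI = size S* ; iar = arity S* ; rules = targetRules ; headed = λ x → headed′ x (role S* x) refl }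
    where
      headed′ : ∀ x (r : Role (arity S* x)) → role S* x ≡ r → Any (λ ρ → head ρ ≡ x) targetRules
      headed′ x (original P e) r = subst (λ y → Any (λ ρ → head ρ ≡ y) targetRules) (embed-onto S* x r)
        (AnyP.++⁺ˡ (translateRules-headed rulesO handles* (headedO P)))
      headed′ x (evaluates b φ) r = AnyP.++⁺ʳ _ (AuxiliaryRules.headed B* x r)

  module Correctness (A : Structure σ) where

    U : Set
    U = Universe A

    stageT : ℕ → SInterp S* U
    stageT = stage target A

    stageO : ℕ → Interp nO arO U
    stageO = stage Π A

    RepresentsAt : ℕ → (x : Fin (size S*)) → Vec U (arity S* x) → Set
    RepresentsAt i x v = ∀ {P e} → role S* x ≡ original P e → stageO i P (subst (Vec U) e v) ≡ true

    SoundAt : ℕ → (x : Fin (size S*)) → Vec U (arity S* x) → Set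
    SoundAt i x v = RepresentsAt i x v × FaithfulAt S* A x v

    SoundStage : ℕ → Set
    SoundStage i = ∀ x v → stageT i x v ≡ true → SoundAt i x v

    translateLit-sound : ∀ i {nv} (s : Vec U nv) (l : LitO nv) (h : FOHandles S* l) → SoundStage i →
                         evalLit A (stageT i) s (translateLit l h) ≡ true → evalLit A (stageO i) s l ≡ true
    translateLit-sound i s (posE R ts) _ _ = id
    translateLit-sound i s (negE R ts) _ _ = id
    translateLit-sound i s (eqA t u)   _ _ = id
    translateLit-sound i s (neqA t u)  _ _ = id
    translateLit-sound i {nv} s (posI P ts) _ sound holds =
      subst (λ w → stageO i P w ≡ true) untranslate (proj₁ (sound _ _ holds) (role-embed S* P))
      where
        e = arity-embed S* P
        untranslate : subst (Vec U) e (map (evalTerm A s) (subst (Vec (Term σ nv)) (sym e) ts)) ≡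
                      map (evalTerm A s) ts
        untranslate = trans (cong (subst (Vec U) e) (map-subst (evalTerm A s) (sym e) ts))
                            (subst-subst-irrelevant (Vec U) (sym e) e refl _)
    translateLit-sound i s (foL _ φ) (Maybe.just h) sound =
      atom-sound A h (λ x v t → proj₂ (sound x v t)) s
    translateLit-sound i s (allI _ P k l e zs) _ sound = everyVec-mono _ k λ _ holds →
      subst (λ w → stageO i P w ≡ true)
            (subst-subst-irrelevant (Vec U) (trans e (sym (arity-embed S* P))) (arity-embed S* P) e _)
            (proj₁ (sound _ _ holds) (role-embed S* P))

    translateLits-sound : ∀ i {nv} (s : Vec U nv) ls (hs : All (FOHandles S*) ls) → SoundStage i →
                          All (λ l → evalLit A (stageT i) s l ≡ true) (translateLits ls hs) →
                          All (λ l → evalLit A (stageO i) s l ≡ true) ls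
    translateLits-sound i s []       []       _     []       = []
    translateLits-sound i s (l ∷ ls) (h ∷ hs) sound (t ∷ ts) =
      translateLit-sound i s l h sound t ∷ translateLits-sound i s ls hs sound ts

    translateRule-sound : ∀ i {ρ₀} → ρ₀ ∈ rulesO → ∀ hs s → SoundStage i →
                          BodyHolds A (stageT i) (translateRule ρ₀ hs) s →
                          RepresentsAt (suc i) (embed S* (head ρ₀))
                                       (map (lookup s) (hargs (translateRule ρ₀ hs)))
    translateRule-sound i {ρ₀} ρ₀∈ hs s sound bd r with trans (sym (role-embed S* (head ρ₀))) r
    ... | refl = stage-suc⁺ Π A i
      (derive ρ₀ ρ₀∈ s (refl , sym untranslate) (translateLits-sound i s (body ρ₀) hs sound bd))
      where
        e = arity-embed S* (head ρ₀)
        untranslate : subst (Vec U) e (map (lookup s) (subst (Vec (Fin (Rule.nv ρ₀))) (sym e) (hargs ρ₀))) ≡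
                      map (lookup s) (hargs ρ₀)
        untranslate = trans (cong (subst (Vec U) e) (map-subst (lookup s) (sym e) (hargs ρ₀)))
                            (subst-subst-irrelevant (Vec U) (sym e) e refl _)

    derived-sound : ∀ i {ρ} → ρ ∈ targetRules → ∀ s → SoundStage i → BodyHolds A (stageT i) ρ s →
                    SoundAt (suc i) (head ρ) (map (lookup s) (hargs ρ))
    derived-sound i ρ∈ s sound bd with ∈-++⁻ (translateRules rulesO handles*) ρ∈
    ... | inj₂ ρ∈aux =
      (λ r → ⊥-elim (original≢evaluates r (proj₂ (proj₂ (AuxiliaryRules.head-aux B* ρ∈aux))))) ,
      AuxiliaryRules.sound B* ρ∈aux A (stageT i) s (λ x v t → proj₂ (sound x v t)) bd
    ... | inj₁ ρ∈tr with translateRules⁻ rulesO handles* ρ∈tr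
    ...   | ρ₀ , ρ₀∈ , hs , refl =
      translateRule-sound i ρ₀∈ hs s sound bd , λ r → ⊥-elim (original≢evaluates (role-embed S* (head ρ₀)) r)

    translation-sound : ∀ i → SoundStage i
    translation-sound zero    x v ()
    translation-sound (suc i) x v holds with stage-suc⁻ target A i holds
    ... | derive ρ ρ∈ s hd bd =
      head-is-elim A {ρ} {s} (SoundAt (suc i)) hd (derived-sound i ρ∈ s (translation-sound i) bd)

    auxiliary-complete : ∀ t → CompleteBelow S* A (stageT t) t
    auxiliary-complete zero    x r ()
    auxiliary-complete (suc t) x r (s≤s x≤t) v φv =
      stage-suc⁺ target A t (derivation-mono A (∈-++⁺ʳ _)
        (AuxiliaryRules.complete B* x r A (stageT t)
          (CompleteBelow-mono S* A x≤t (auxiliary-complete t)) v φv))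

    CompleteStage : ℕ → Set
    CompleteStage i = ∀ P v → stageO i P v ≡ true →
                      stageT (height S* + i) (embed S* P) (subst (Vec U) (sym (arity-embed S* P)) v) ≡ true

    translateLit-complete : ∀ i {nv} (s : Vec U nv) (l : LitO nv) (h : FOHandles S* l) → CompleteStage i →
                            evalLit A (stageO i) s l ≡ true →
                            evalLit A (stageT (height S* + i)) s (translateLit l h) ≡ true
    translateLit-complete i s (posE R ts) _ _ = id
    translateLit-complete i s (negE R ts) _ _ = id
    translateLit-complete i s (eqA t u)   _ _ = id
    translateLit-complete i s (neqA t u)  _ _ = id
    translateLit-complete i s (posI P ts) _ complete holds =
      subst (λ w → stageT (height S* + i) (embed S* P) w ≡ true)
            (sym (map-subst (evalTerm A s) (sym (arity-embed S* P)) ts)) (complete P _ holds)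
    translateLit-complete i s (foL _ φ) (Maybe.just h) _ =
      atom-complete A h (CompleteBelow-mono S* A (m≤m+n (height S*) i) (auxiliary-complete (height S* + i)))
                    (level<height S* (symbol h)) s
    translateLit-complete i s (allI _ P k l e zs) _ complete = everyVec-mono _ k λ _ holds →
      subst (λ w → stageT (height S* + i) (embed S* P) w ≡ true)
            (subst-subst-irrelevant (Vec U) e (sym (arity-embed S* P)) (trans e (sym (arity-embed S* P))) _)
            (complete P _ holds)

    translateLits-complete : ∀ i {nv} (s : Vec U nv) ls (hs : All (FOHandles S*) ls) → CompleteStage i →
                             All (λ l → evalLit A (stageO i) s l ≡ true) ls →
                             All (λ l → evalLit A (stageT (height S* + i)) s l ≡ true) (translateLits ls hs)
    translateLits-complete i s []       []       _        []       = []
    translateLits-complete i s (l ∷ ls) (h ∷ hs) complete (t ∷ ts) =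
      translateLit-complete i s l h complete t ∷ translateLits-complete i s ls hs complete ts

    translation-complete : ∀ i → CompleteStage i
    translation-complete zero    P v ()
    translation-complete (suc i) P v holds with stage-suc⁻ Π A i holds
    ... | derive ρ₀ ρ₀∈ s (refl , refl) bd =
      subst (λ t → stageT t (embed S* (head ρ₀)) v′ ≡ true) (sym (+-suc (height S*) i))
        (stage-suc⁺ target A (height S* + i)
          (derive (translateRule ρ₀ hs) (∈-++⁺ˡ (translateRules⁺ rulesO handles* ρ₀∈)) s
                  (refl , map-subst (lookup s) (sym (arity-embed S* (head ρ₀))) (hargs ρ₀))
                  (translateLits-complete i s (body ρ₀) hs (translation-complete i) bd)))
      where
        hs = All.lookup handles* ρ₀∈
        v′ = subst (Vec U) (sym (arity-embed S* (head ρ₀))) (map (lookup s) (hargs ρ₀))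

    translation-correct : ∀ P v → InFixpoint Π A P v ⇔
                          InFixpoint target A (embed S* P) (subst (Vec U) (sym (arity-embed S* P)) v)
    translation-correct P v = mk⇔
      (λ (i , holds) → height S* + i , translation-complete i P v holds)
      (λ (i , holds) → i , subst (λ w → stageO i P w ≡ true)
                                 (subst-subst-irrelevant (Vec U) (sym e) e refl v)
                                 (proj₁ (translation-sound i _ _ holds) (role-embed S* P)))
      where e = arity-embed S* P

DATALOG*ʳ⊑DATALOGʳ : DATALOG*ʳ ⊑ DATALOGʳ
DATALOG*ʳ⊑DATALOGʳ σ r φ = ψ , λ A ā →
  subst (λ w → Holds φ A ā ⇔ InFixpoint target A (embed S* goal) w)
        (subst-subst-irrelevant (Vec (Universe A)) (sym goalAr) (sym (arity-embed S* goal))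
                                (sym (trans (arity-embed S* goal) goalAr)) ā)
        (Correctness.translation-correct A goal (subst (Vec (Universe A)) (sym goalAr) ā))
  where
    open DFormula φ
    open Translation prog
    open Signature
    ψ : DFormula DATALOGʳ σ r
    ψ = record { prog = target ; goal = embed S* goal ; goalAr = trans (arity-embed S* goal) goalAr }

corollary2 : (DATALOG* ⊑ DATALOGʳ) × (DATALOGʳ ≡ᴸ DATALOG*ʳ)
corollary2 = ⊑-trans (widen⊑ {DATALOG*} {DATALOG*ʳ} id λ ()) DATALOG*ʳ⊑DATALOGʳ ,
             widen⊑ {DATALOGʳ} {DATALOG*ʳ} (λ ()) id , DATALOG*ʳ⊑DATALOGʳ
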